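{- The logic $\mathbf{IL}^-(\mathbf{J1},\mathbf{J4},\mathbf{J5})$ does not prove the schema $\mathbf{J4}_+$; that is, some instance $\Box(A\to B)\to(C\rhd A\to C\rhd B)$ is not a theorem of $\mathbf{IL}^-(\mathbf{J1},\mathbf{J4},\mathbf{J5})$.
   Context: Formulas are built from countably many propositional variables, $\top,\bot$, $\neg,\land,\lor,\to$, unary $\Box$ and binary $\rhd$; $\Diamond A$ abbreviates $\neg\Box\neg A$. The logic $\mathbf{IL}^-$ has as axioms all tautologies, $\Box(A\to B)\to(\Box A\to\Box B)$, $\Box(\Box A\to A)\to\Box A$, $(A\rhd C)\land(B\rhd C)\to(A\lor B)\rhd C$, and $\Box A\leftrightarrow(\neg A)\rhd\bot$; rules: modus ponens, necessitation, from $A\to B$ infer $C\rhd A\to C\rhd B$, from $A\to B$ infer $B\rhd C\to A\rhd C$. $\mathbf{IL}^-(\Sigma_1,\dots,\Sigma_n)$ is $\mathbf{IL}^-$ with schemata $\Sigma_i$ added as axioms. Schemata: $\mathbf{J1}$: $\Box(A\to B)\to A\rhd B$; $\mathbf{J4}$: $A\rhd B\to(\Diamond A\to\Diamond B)$; $\mathbf{J4}_+$: $\Box(A\to B)\to(C\rhd A\to C\rhd B)$; $\mathbf{J5}$: $\Diamond A\rhd A$. -}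

module Defs where

open import Data.Nat using (ℕ)
open import Data.Bool using (Bool; true; false; not; _∧_; _∨_)
open import Relation.Binary.PropositionalEquality using (_≡_)
open import Data.Product using (∃)

infixr 6 _∧'_
infixr 5 _∨'_
infixr 4 _⇒_
infix 7 _▷_
infix 3 _⇔_
infix 9 □_ ◇_ ¬'_

data Fm : Set where
  var  : ℕ → Fm
  ⊤'   : Fm
  ⊥'   : Fm
  ¬'_  : Fm → Fm
  _∧'_ : Fm → Fm → Fm
  _∨'_ : Fm → Fm → Fm
  _⇒_  : Fm → Fm → Fm
  □_   : Fm → Fm
  _▷_  : Fm → Fm → Fm

◇_ : Fm → Fm
◇ A = ¬' (□ (¬' A))

_⇔_ : Fm → Fm → Fm
A ⇔ B = (A ⇒ B) ∧' (B ⇒ A)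

-- Classical truth evaluation, where v assigns truth values to the
-- propositional "atoms": variables, □-formulas and ▷-formulas.
_⇒ᵇ_ : Bool → Bool → Bool
a ⇒ᵇ b = not a ∨ b

eval : (Fm → Bool) → Fm → Bool
eval v (var n)  = v (var n)
eval v ⊤'       = true
eval v ⊥'       = false
eval v (¬' A)   = not (eval v A)
eval v (A ∧' B) = eval v A ∧ eval v B
eval v (A ∨' B) = eval v A ∨ eval v B
eval v (A ⇒ B)  = eval v A ⇒ᵇ eval v B
eval v (□ A)    = v (□ A)
eval v (A ▷ B)  = v (A ▷ B)

-- A is a tautology: true under every assignment to its propositional atoms
-- (i.e. A is an instance of a propositional tautology).
Tautology : Fm → Set
Tautology A = (v : Fm → Bool) → eval v A ≡ true

data ⊢ : Fm → Set where
  taut   : ∀ {A} → Tautology A → ⊢ A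
  axK    : ∀ A B → ⊢ (□ (A ⇒ B) ⇒ (□ A ⇒ □ B))
  axL    : ∀ A → ⊢ (□ (□ A ⇒ A) ⇒ □ A)
  axJ3   : ∀ A B C → ⊢ ((A ▷ C) ∧' (B ▷ C) ⇒ (A ∨' B) ▷ C)
  axJ6   : ∀ A → ⊢ (□ A ⇔ ((¬' A) ▷ ⊥'))
  axJ1   : ∀ A B → ⊢ (□ (A ⇒ B) ⇒ A ▷ B)
  axJ4   : ∀ A B → ⊢ (A ▷ B ⇒ (◇ A ⇒ ◇ B))
  axJ5   : ∀ A → ⊢ ((◇ A) ▷ A)
  mp     : ∀ {A B} → ⊢ (A ⇒ B) → ⊢ A → ⊢ B
  nec    : ∀ {A} → ⊢ A → ⊢ (□ A)
  ruleR1 : ∀ {A B} C → ⊢ (A ⇒ B) → ⊢ (C ▷ A ⇒ C ▷ B)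
  ruleR2 : ∀ {A B} C → ⊢ (A ⇒ B) → ⊢ (B ▷ C ⇒ A ▷ C)

J4₊ : Fm → Fm → Fm → Fm
J4₊ A B C = □ (A ⇒ B) ⇒ (C ▷ A ⇒ C ▷ B)

module Submission where

-- The proof is semantic: we exhibit a finite generalised Veltman frame
-- (in the style of IL⁻-frames) validating IL⁻(J1,J4,J5) but not J4₊.
-- It has a root r and three dead-end leaves x₁, x₂, z, with
--   R[r] = {x₁, x₂},    x₁ S_r {x₁},  x₁ S_r {x₂, z},  x₂ S_r {x₂},
-- so r ⊩ A ▷ B iff every R-successor of r forcing A has an S_r-neighbourhood
-- inside ⟦B⟧.  The neighbourhood {x₂, z} leaves R[r]: this breaks J4₊ but
-- not J4, which only needs every neighbourhood to meet R[r].
--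
-- At a leaf, □ and ▷ are vacuously true, so every axiom holds there by
-- computation.  At the root, □ and ▷ only look at the truth values of their
-- arguments at the three leaves; each axiom and rule thus becomes a Boolean
-- law about such triples, checked by a truth table.  Together these give
-- soundness for every valuation; a suitable valuation refutes J4₊ at r.

open import Defs
open import Data.Product using (∃-syntax; _,_)
open import Relation.Nullary using (¬_)
open import Data.Nat using (ℕ)
open import Data.Bool using (Bool; true; false; not; _∧_; _∨_)
open import Data.Bool.Properties using (∧-conicalˡ; ∧-conicalʳ; ∨-inverseˡ)
open import Relation.Binary.PropositionalEquality using (_≡_; refl; sym; trans)

mpᵇ : ∀ {x y} → (x ⇒ᵇ y) ≡ true → x ≡ true → y ≡ true
mpᵇ x⇒y refl = x⇒y

∧-intro : ∀ {x y} → x ≡ true → y ≡ true → (x ∧ y) ≡ true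
∧-intro refl y = y

data Leaf : Set where
  x₁ x₂ z : Leaf

data World : Set where
  root : World
  leaf : Leaf → World

-- The truth values of a formula at the leaves x₁, x₂, z: all that the
-- root's □ and ▷ depend on.
record LeafExt : Set where
  constructor ⟨_,_,_⟩
  field
    at-x₁ at-x₂ at-z : Bool
open LeafExt

pointwise : (Bool → Bool → Bool) → LeafExt → LeafExt → LeafExt
pointwise _⊙_ a b = ⟨ at-x₁ a ⊙ at-x₁ b , at-x₂ a ⊙ at-x₂ b , at-z a ⊙ at-z b ⟩

_⇒ₑ_ _∨ₑ_ : LeafExt → LeafExt → LeafExt
_⇒ₑ_ = pointwise _⇒ᵇ_
_∨ₑ_ = pointwise _∨_

¬ₑ_ : LeafExt → LeafExt
¬ₑ a = ⟨ not (at-x₁ a) , not (at-x₂ a) , not (at-z a) ⟩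

⊥ₑ : LeafExt
⊥ₑ = ⟨ false , false , false ⟩

allₑ : LeafExt → Bool
allₑ a = at-x₁ a ∧ at-x₂ a ∧ at-z a

-- □ at the root: truth at both R-successors x₁ and x₂.
box : LeafExt → Bool
box a = at-x₁ a ∧ at-x₂ a

-- ▷ at the root: x₁ forcing A is covered by {x₁} or {x₂, z},
-- x₂ forcing A is covered by {x₂}.
rhd : LeafExt → LeafExt → Bool
rhd a b = (at-x₁ a ⇒ᵇ (at-x₁ b ∨ (at-x₂ b ∧ at-z b))) ∧ (at-x₂ a ⇒ᵇ at-x₂ b)

∀ᵇ : (Bool → Bool) → Bool
∀ᵇ f = f true ∧ f false

∀ᵇ-sound : (f : Bool → Bool) → ∀ᵇ f ≡ true → ∀ b → f b ≡ true
∀ᵇ-sound f all true  = ∧-conicalˡ (f true) (f false) all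
∀ᵇ-sound f all false = ∧-conicalʳ (f true) (f false) all

∀ₑ : (LeafExt → Bool) → Bool
∀ₑ f = ∀ᵇ λ p → ∀ᵇ λ q → ∀ᵇ λ r → f ⟨ p , q , r ⟩

∀ₑ-sound : (f : LeafExt → Bool) → ∀ₑ f ≡ true → ∀ a → f a ≡ true
∀ₑ-sound f all ⟨ p , q , r ⟩ =
  ∀ᵇ-sound (λ r → f ⟨ p , q , r ⟩)
    (∀ᵇ-sound (λ q → ∀ᵇ λ r → f ⟨ p , q , r ⟩)
      (∀ᵇ-sound (λ p → ∀ᵇ λ q → ∀ᵇ λ r → f ⟨ p , q , r ⟩) all p) q) r

truthTable₂ : (f : LeafExt → LeafExt → Bool) →
              ∀ₑ (λ a → ∀ₑ (f a)) ≡ true → ∀ a b → f a b ≡ true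
truthTable₂ f all a = ∀ₑ-sound (f a) (∀ₑ-sound (λ a → ∀ₑ (f a)) all a)

truthTable₃ : (f : LeafExt → LeafExt → LeafExt → Bool) →
              ∀ₑ (λ a → ∀ₑ λ b → ∀ₑ (f a b)) ≡ true → ∀ a b c → f a b c ≡ true
truthTable₃ f all a =
  truthTable₂ (f a) (∀ₑ-sound (λ a → ∀ₑ λ b → ∀ₑ (f a b)) all a)

-- The Boolean laws of the root's □ and ▷, one for each axiom or rule.
-- J5 needs none: ◇A fails at every leaf.  Löb needs none either: □A holds at
-- every leaf, so at the root □(□A → A) reduces to □A itself.
K-law : ∀ a b → (box (a ⇒ₑ b) ⇒ᵇ (box a ⇒ᵇ box b)) ≡ true
K-law = truthTable₂ (λ a b → box (a ⇒ₑ b) ⇒ᵇ (box a ⇒ᵇ box b)) refl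

J3-law : ∀ a b c → ((rhd a c ∧ rhd b c) ⇒ᵇ rhd (a ∨ₑ b) c) ≡ true
J3-law = truthTable₃ (λ a b c → (rhd a c ∧ rhd b c) ⇒ᵇ rhd (a ∨ₑ b) c) refl

J6-law : ∀ a → ((box a ⇒ᵇ rhd (¬ₑ a) ⊥ₑ) ∧ (rhd (¬ₑ a) ⊥ₑ ⇒ᵇ box a)) ≡ true
J6-law = ∀ₑ-sound (λ a → (box a ⇒ᵇ rhd (¬ₑ a) ⊥ₑ) ∧ (rhd (¬ₑ a) ⊥ₑ ⇒ᵇ box a)) refl

-- J1 holds because every R-successor y of the root has y S_r {y}.
J1-law : ∀ a b → (box (a ⇒ₑ b) ⇒ᵇ rhd a b) ≡ true
J1-law = truthTable₂ (λ a b → box (a ⇒ₑ b) ⇒ᵇ rhd a b) refl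

-- J4 holds because every neighbourhood meets R[r].
J4-law : ∀ a b → (rhd a b ⇒ᵇ (not (box (¬ₑ a)) ⇒ᵇ not (box (¬ₑ b)))) ≡ true
J4-law = truthTable₂ (λ a b → rhd a b ⇒ᵇ (not (box (¬ₑ a)) ⇒ᵇ not (box (¬ₑ b)))) refl

nec-law : ∀ a → (allₑ a ⇒ᵇ box a) ≡ true
nec-law = ∀ₑ-sound (λ a → allₑ a ⇒ᵇ box a) refl

R1-law : ∀ a b c → (allₑ (a ⇒ₑ b) ⇒ᵇ (rhd c a ⇒ᵇ rhd c b)) ≡ true
R1-law = truthTable₃ (λ a b c → allₑ (a ⇒ₑ b) ⇒ᵇ (rhd c a ⇒ᵇ rhd c b)) refl

R2-law : ∀ a b c → (allₑ (a ⇒ₑ b) ⇒ᵇ (rhd b c ⇒ᵇ rhd a c)) ≡ true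
R2-law = truthTable₃ (λ a b c → allₑ (a ⇒ₑ b) ⇒ᵇ (rhd b c ⇒ᵇ rhd a c)) refl

module Model (val : World → ℕ → Bool) where

  infix 2 _⊩_
  _⊩_ : World → Fm → Bool
  ⟦_⟧ : Fm → LeafExt

  u ⊩ var n       = val u n
  u ⊩ ⊤'          = true
  u ⊩ ⊥'          = false
  u ⊩ ¬' A        = not (u ⊩ A)
  u ⊩ A ∧' B      = (u ⊩ A) ∧ (u ⊩ B)
  u ⊩ A ∨' B      = (u ⊩ A) ∨ (u ⊩ B)
  u ⊩ A ⇒ B       = (u ⊩ A) ⇒ᵇ (u ⊩ B)
  root ⊩ □ A      = box ⟦ A ⟧
  leaf _ ⊩ □ A    = true
  root ⊩ A ▷ B    = rhd ⟦ A ⟧ ⟦ B ⟧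
  leaf _ ⊩ A ▷ B  = true

  ⟦ A ⟧ = ⟨ leaf x₁ ⊩ A , leaf x₂ ⊩ A , leaf z ⊩ A ⟩

  ⊩-classical : ∀ u A → (u ⊩ A) ≡ eval (u ⊩_) A
  ⊩-classical u (var n)  = refl
  ⊩-classical u ⊤'       = refl
  ⊩-classical u ⊥'       = refl
  ⊩-classical u (¬' A)   rewrite ⊩-classical u A = refl
  ⊩-classical u (A ∧' B) rewrite ⊩-classical u A | ⊩-classical u B = refl
  ⊩-classical u (A ∨' B) rewrite ⊩-classical u A | ⊩-classical u B = refl
  ⊩-classical u (A ⇒ B)  rewrite ⊩-classical u A | ⊩-classical u B = refl
  ⊩-classical u (□ A)    = refl
  ⊩-classical u (A ▷ B)  = refl

  Valid : Fm → Set
  Valid A = ∀ u → (u ⊩ A) ≡ true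

  valid-at-leaves : ∀ A → Valid A → allₑ ⟦ A ⟧ ≡ true
  valid-at-leaves A v = ∧-intro (v (leaf x₁)) (∧-intro (v (leaf x₂)) (v (leaf z)))

  sound : ∀ {A} → ⊢ A → Valid A
  sound (taut {A} t)   u        = trans (⊩-classical u A) (t (u ⊩_))
  sound (mp d e)       u        = mpᵇ (sound d u) (sound e u)
  sound (axK A B)      root     = K-law ⟦ A ⟧ ⟦ B ⟧
  sound (axL A)        root     = ∨-inverseˡ (box ⟦ A ⟧)
  sound (axJ3 A B C)   root     = J3-law ⟦ A ⟧ ⟦ B ⟧ ⟦ C ⟧
  sound (axJ6 A)       root     = J6-law ⟦ A ⟧
  sound (axJ1 A B)     root     = J1-law ⟦ A ⟧ ⟦ B ⟧
  sound (axJ4 A B)     root     = J4-law ⟦ A ⟧ ⟦ B ⟧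
  sound (axJ5 A)       root     = refl
  sound (nec {A} d)    root     = mpᵇ (nec-law ⟦ A ⟧) (valid-at-leaves A (sound d))
  sound (ruleR1 {A} {B} C d) root =
    mpᵇ (R1-law ⟦ A ⟧ ⟦ B ⟧ ⟦ C ⟧) (valid-at-leaves (A ⇒ B) (sound d))
  sound (ruleR2 {A} {B} C d) root =
    mpᵇ (R2-law ⟦ A ⟧ ⟦ B ⟧ ⟦ C ⟧) (valid-at-leaves (A ⇒ B) (sound d))
  sound (axK A B)      (leaf _) = refl
  sound (axL A)        (leaf _) = refl
  sound (axJ3 A B C)   (leaf _) = refl
  sound (axJ6 A)       (leaf _) = refl
  sound (axJ1 A B)     (leaf _) = refl
  sound (axJ4 A B)     (leaf _) = refl
  sound (axJ5 A)       (leaf _) = refl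
  sound (nec d)        (leaf _) = refl
  sound (ruleR1 C d)   (leaf _) = refl
  sound (ruleR2 C d)   (leaf _) = refl

-- The refuting valuation: p₀ holds at x₂ and z, p₁ at x₂, p₂ at x₁.
-- Then r ⊩ □(p₀ → p₁) and r ⊩ p₂ ▷ p₀ (via x₁ S_r {x₂, z}), but
-- r ⊮ p₂ ▷ p₁, since p₁ fails at x₁ and at z.
countervaluation : World → ℕ → Bool
countervaluation (leaf x₂) 0 = true
countervaluation (leaf z)  0 = true
countervaluation (leaf x₂) 1 = true
countervaluation (leaf x₁) 2 = true
countervaluation _         _ = false

open Model countervaluation

J4₊-refuted : (root ⊩ J4₊ (var 0) (var 1) (var 2)) ≡ false
J4₊-refuted = refl

proposition6p3 : ∃[ A ] ∃[ B ] ∃[ C ] ¬ ⊢ (J4₊ A B C)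
proposition6p3 = var 0 , var 1 , var 2 , unprovable
  where
  unprovable : ¬ ⊢ (J4₊ (var 0) (var 1) (var 2))
  unprovable d with trans (sym J4₊-refuted) (sound d root)
  ... | ()
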